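{- Let $T$ be an increasing balanced path diagram and let $k$ be the number of its arrows starting at level $0$. Whether Step 2 of Algorithm $\mathrm{HPath}^{\phi_k^{ -1}}$ labels all $N$ arrows of $T$ (i.e. whether $T$ is stable) does not depend on the choice of the permutation $\phi_k\in\mathfrak S_k$.
   Context: A path diagram $T(P,R)$, $P=(b_1,\dots,b_N)$, $R=(r_1,\dots,r_N)$, consists of arrows $A_i=(1,b_i)$ starting at $(i,r_i)$ with end rank $r_i+b_i$. Red arrow: $b_i>0$, segment in row $j$ (strip between heights $j,j+1$) iff $r_i\le j\le r_i+b_i-1$; blue: $b_i<0$, segment in row $j$ iff $r_i+b_i\le j\le r_i-1$. Row count $c(j)$ = #red minus #blue segments in row $j$; balanced: all $c(j)=0$; increasing: $r_1\le\dots\le r_N$. Step 2 of Algorithm $\mathrm{HPath}^{\phi_k^{ -1}}$: start with current level $0$ and counter $\mathfrak n=0$; for $i=1,\dots,N$: if the current level is $0$, set $\mathfrak n:=\mathfrak n+1$ and let $A_j$ be the $\phi_k^{ -1}(\mathfrak n)$-th arrow from the left among those starting at level $0$; otherwise let $A_j$ be the rightmost unlabelled arrow starting at the current level. If none exists, Step 2 stops early; else label $A_j$ by $i$ and set the current level to the end rank of $A_j$. $T$ is called stable if Step 2 labels all $N$ arrows. -}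

module Defs where

open import Data.Bool using (Bool; true; false; if_then_else_)
open import Data.Nat as ℕ using (ℕ; zero; suc; _∸_)
open import Data.Integer as ℤ using (ℤ; _+_; _-_; -_; _≤_; _<_; 0ℤ; 1ℤ)
open import Data.Fin as Fin using (Fin; fromℕ<)
open import Data.Fin.Permutation using (Permutation′; _⟨$⟩ˡ_)
open import Data.List as List using (List; []; _∷_; filter; allFin; foldr; map; reverse; length)
open import Data.List.Relation.Unary.Any using (any?)
open import Data.Maybe using (Maybe; just; nothing; _>>=_; Is-just)
open import Relation.Nullary using (Dec; yes; no; ¬_)
open import Relation.Nullary.Decidable using (⌊_⌋; _×-dec_; ¬?)
open import Relation.Binary.PropositionalEquality using (_≡_)
open import Data.Product using (_×_)

-- A path diagram T(P,R) with N arrows: b i = b_{i+1}, r i = r_{i+1} (0-indexed arrows).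

-- contribution of arrow i to row j: +1 red segment, -1 blue segment, 0 otherwise
segment : ℤ → ℤ → ℤ → ℤ
segment b r j with 0ℤ ℤ.<? b | b ℤ.<? 0ℤ
... | yes _ | _ = if ⌊ (r ℤ.≤? j) ×-dec (j ℤ.≤? (r + b - 1ℤ)) ⌋ then 1ℤ else 0ℤ
... | no _ | yes _ = if ⌊ ((r + b) ℤ.≤? j) ×-dec (j ℤ.≤? (r - 1ℤ)) ⌋ then - 1ℤ else 0ℤ
... | no _ | no _ = 0ℤ

rowCount : {N : ℕ} → (b r : Fin N → ℤ) → ℤ → ℤ
rowCount {N} b r j = foldr _+_ 0ℤ (map (λ i → segment (b i) (r i) j) (allFin N))

Balanced : {N : ℕ} → (b r : Fin N → ℤ) → Set
Balanced b r = ∀ (j : ℤ) → rowCount b r j ≡ 0ℤ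

Increasing : {N : ℕ} → (r : Fin N → ℤ) → Set
Increasing r = ∀ i j → i Fin.≤ j → r i ≤ r j

level0 : {N : ℕ} → (r : Fin N → ℤ) → List (Fin N)
level0 {N} r = filter (λ i → r i ℤ.≟ 0ℤ) (allFin N)

numLevel0 : {N : ℕ} → (r : Fin N → ℤ) → ℕ
numLevel0 r = length (level0 r)

record State (N : ℕ) : Set where
  constructor st
  field
    level    : ℤ
    counter  : ℕ
    labelled : List (Fin N)

isLabelled : {N : ℕ} → List (Fin N) → Fin N → Bool
isLabelled L i = ⌊ any? (λ j → i Fin.≟ j) L ⌋

findFirst : {A : Set} → (A → Bool) → List A → Maybe A
findFirst p [] = nothing
findFirst p (x ∷ xs) = if p x then just x else findFirst p xs

rightmostAt : {N : ℕ} → (r : Fin N → ℤ) → List (Fin N) → ℤ → Maybe (Fin N)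
rightmostAt {N} r L ℓ =
  findFirst (λ i → ⌊ (r i ℤ.≟ ℓ) ×-dec ¬? (any? (λ j → i Fin.≟ j) L) ⌋) (reverse (allFin N))

-- the m-th (1-indexed) arrow from the left among those at level 0,
-- with m = φ⁻¹(n); nothing if n is out of range 1..k
chooseLevel0 : {N : ℕ} → (r : Fin N → ℤ) → Permutation′ (numLevel0 r) → ℕ → Maybe (Fin N)
chooseLevel0 r φ n with (n ∸ 1) ℕ.<? numLevel0 r
... | yes p = just (List.lookup (level0 r) (φ ⟨$⟩ˡ fromℕ< p))
... | no _ = nothing

-- one iteration of Step 2 (nothing = Step 2 stops early)
step : {N : ℕ} → (b r : Fin N → ℤ) → Permutation′ (numLevel0 r) → State N → Maybe (State N)
step b r φ (st ℓ n L) with ℓ ℤ.≟ 0ℤ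
... | yes _ = chooseLevel0 r φ (suc n) >>= λ j →
                if isLabelled L j then nothing
                else just (st (r j + b j) (suc n) (j ∷ L))
... | no _ = rightmostAt r L ℓ >>= λ j → just (st (r j + b j) n (j ∷ L))

run : {N : ℕ} → (b r : Fin N → ℤ) → Permutation′ (numLevel0 r) → ℕ → State N → Maybe (State N)
run b r φ zero s = just s
run b r φ (suc m) s = step b r φ s >>= run b r φ m

Stable : {N : ℕ} → (b r : Fin N → ℤ) → Permutation′ (numLevel0 r) → Set
Stable {N} b r φ = Is-just (run b r φ N (st 0ℤ 0 []))

module Submission where

-- Step 2 only ever extends a trail. Its labelled arrows L and current level ℓ satisfy
-- Kirchhoff's law (at each level m, #L-arrows entering m + [m = 0] = [m = ℓ] + #L-arrows
-- leaving m), and at each level ≠ 0 the labelled arrows lie to the right of the unlabelled ones.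
-- A row count is #(starts ≤ m) − #(ends ≤ m), so in a balanced diagram as many arrows start as
-- end at each level; a trail ending at ℓ ≠ 0 has entered ℓ once more than it has left it, so it
-- can always continue. Thus Step 2 stops only at level 0 with every level-0 arrow labelled, and
-- the labelled set U is then closed. A run with another permutation never leaves such a U: its
-- level-0 choices lie in U, and at a level ℓ ≠ 0 the same count shows that U has an unlabelled
-- arrow leaving ℓ, hence, by right-closedness, contains the rightmost one. So a run that stops
-- early for one permutation forces every other run to label fewer than N arrows.

open import Data.Bool using (Bool; true; false; if_then_else_; T)
open import Data.Empty using (⊥; ⊥-elim)
open import Data.Fin as Fin using (Fin; zero; suc; fromℕ<)
open import Data.Fin.Permutation as Perm using (Permutation′; _⟨$⟩ˡ_)
import Data.Fin.Properties as Fin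
open import Data.Integer as ℤ using (ℤ; 0ℤ; 1ℤ; -1ℤ; _≤?_; _≟_)
import Data.Integer.Properties as ℤ
open import Algebra.Properties.AbelianGroup ℤ.+-0-abelianGroup using (∙-cancelʳ; \\-leftDividesʳ)
open import Algebra.Properties.CommutativeMonoid.Sum ℤ.+-0-commutativeMonoid using (sum; ∑-distrib-+; sum-cong-≗)
open import Data.List using (List; []; _∷_; [_]; _++_; allFin; filter; foldr; length; lookup; map; reverse; tabulate)
open import Data.List.Membership.Propositional using (_∈_; _∉_)
open import Data.List.Membership.Propositional.Properties using (∈-allFin; ∈-filter⁻; ∈-lookup)
open import Data.List.Properties using (unfold-reverse)
open import Data.List.Relation.Binary.Subset.Propositional using (_⊆_)
open import Data.List.Relation.Binary.Subset.Propositional.Properties using (∈-∷⁺ʳ)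
open import Data.List.Relation.Unary.All as All using ()
open import Data.List.Relation.Unary.AllPairs using (AllPairs; _∷_)
open import Data.List.Relation.Unary.AllPairs.Properties using (tabulate⁺-<)
open import Data.List.Relation.Unary.Any as Any using (here; there)
open import Data.List.Relation.Unary.Any.Properties using (reverse⁺; reverse⁻; singleton⁻)
open import Data.List.Relation.Unary.Unique.Propositional using (Unique)
open import Data.List.Relation.Unary.Unique.Propositional.Properties using (allFin⁺; filter⁺)
open import Data.Maybe using (Maybe; just; nothing; _<∣>_; Is-just)
open import Data.Maybe.Properties using (just-injective)
open import Data.Maybe.Relation.Unary.Any using (just)
open import Data.Nat as ℕ using (ℕ; zero; suc; _≤_; _<_; z≤n; s≤s)
import Data.Nat.Properties as ℕ
open import Data.Product as Product using (_×_; _,_; proj₁; proj₂; ∃-syntax)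
open import Data.Unit using (tt)
open import Function using (_∘_; id)
open import Function.Bundles using (_⇔_; mk⇔; Equivalence; Injection)
open import Function.Properties.Inverse using (↔⇒↣)
open import Level using (Level)
open import Relation.Binary using (Rel; Asymmetric; tri<; tri≈; tri>)
open import Relation.Binary.PropositionalEquality hiding ([_])
open import Relation.Nullary using (Dec; yes; no; ¬_; does; contradiction)
open import Relation.Nullary.Decidable using (⌊_⌋; _×-dec_; ¬?; toWitness; fromWitness; decidable-stable)
open import Relation.Unary using (Pred; Decidable)
open import Relation.Unary.Properties using (_∩?_)

open import Defs

private
  variable
    a p q : Level
    n : ℕ

-- Counting in Fin n

indicator : {A : Set a} → Dec A → ℕ
indicator A? = if does A? then 1 else 0

indicator-yes : {A : Set a} (A? : Dec A) → A → indicator A? ≡ 1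
indicator-yes (yes _) _ = refl
indicator-yes (no ¬a) a = contradiction a ¬a

indicator-no : {A : Set a} (A? : Dec A) → ¬ A → indicator A? ≡ 0
indicator-no (yes a) ¬a = contradiction a ¬a
indicator-no (no _)  _  = refl

count : {P : Pred (Fin n) p} → Decidable P → ℕ
count {n = zero}  P? = 0
count {n = suc n} P? = indicator (P? zero) ℕ.+ count (P? ∘ suc)

count-mono : {P : Pred (Fin n) p} {Q : Pred (Fin n) q} (P? : Decidable P) (Q? : Decidable Q) →
             (∀ {i} → P i → Q i) → count P? ≤ count Q?
count-mono {n = zero}  P? Q? P⊆Q = z≤n
count-mono {n = suc n} P? Q? P⊆Q with P? zero | Q? zero
... | yes p | no ¬q = contradiction (P⊆Q p) ¬q
... | yes _ | yes _ = s≤s (count-mono (P? ∘ suc) (Q? ∘ suc) P⊆Q)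
... | no _  | yes _ = ℕ.m≤n⇒m≤1+n (count-mono (P? ∘ suc) (Q? ∘ suc) P⊆Q)
... | no _  | no _  = count-mono (P? ∘ suc) (Q? ∘ suc) P⊆Q

count-mono-< : {P : Pred (Fin n) p} {Q : Pred (Fin n) q} (P? : Decidable P) (Q? : Decidable Q) →
               (∀ {i} → P i → Q i) → ∀ {j} → ¬ P j → Q j → count P? < count Q?
count-mono-< P? Q? P⊆Q {zero} ¬pj qj with P? zero | Q? zero
... | yes p | _     = contradiction p ¬pj
... | no _  | no ¬q = contradiction qj ¬q
... | no _  | yes _ = s≤s (count-mono (P? ∘ suc) (Q? ∘ suc) P⊆Q)
count-mono-< P? Q? P⊆Q {suc j} ¬pj qj with P? zero | Q? zero
... | yes p | no ¬q = contradiction (P⊆Q p) ¬q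
... | yes _ | yes _ = s≤s (count-mono-< (P? ∘ suc) (Q? ∘ suc) P⊆Q ¬pj qj)
... | no _  | yes _ = ℕ.m<n⇒m<1+n (count-mono-< (P? ∘ suc) (Q? ∘ suc) P⊆Q ¬pj qj)
... | no _  | no _  = count-mono-< (P? ∘ suc) (Q? ∘ suc) P⊆Q ¬pj qj

count-cong : {P : Pred (Fin n) p} {Q : Pred (Fin n) q} (P? : Decidable P) (Q? : Decidable Q) →
             (∀ {i} → P i ⇔ Q i) → count P? ≡ count Q?
count-cong P? Q? P⇔Q =
  ℕ.≤-antisym (count-mono P? Q? (Equivalence.to P⇔Q)) (count-mono Q? P? (Equivalence.from P⇔Q))

count-insert : {P : Pred (Fin n) p} {Q : Pred (Fin n) q} (P? : Decidable P) (Q? : Decidable Q) →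
               ∀ {j} → ¬ P j → Q j → (∀ {i} → i ≢ j → P i ⇔ Q i) → count Q? ≡ suc (count P?)
count-insert P? Q? {zero} ¬pj qj P⇔Q with P? zero | Q? zero
... | yes p | _     = contradiction p ¬pj
... | no _  | no ¬q = contradiction qj ¬q
... | no _  | yes _ = cong suc (sym (count-cong (P? ∘ suc) (Q? ∘ suc) (P⇔Q λ ())))
count-insert P? Q? {suc j} ¬pj qj P⇔Q with P? zero | Q? zero
... | yes p | no ¬q = contradiction (Equivalence.to (P⇔Q λ ()) p) ¬q
... | no ¬p | yes q = contradiction (Equivalence.from (P⇔Q λ ()) q) ¬p
... | yes _ | yes _ = cong suc (count-insert (P? ∘ suc) (Q? ∘ suc) ¬pj qj (P⇔Q ∘ (_∘ Fin.suc-injective)))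
... | no _  | no _  = count-insert (P? ∘ suc) (Q? ∘ suc) ¬pj qj (P⇔Q ∘ (_∘ Fin.suc-injective))

count-∅ : {P : Pred (Fin n) p} (P? : Decidable P) → (∀ {i} → ¬ P i) → count P? ≡ 0
count-∅ {n = zero}  P? ¬P = refl
count-∅ {n = suc n} P? ¬P with P? zero
... | yes p = contradiction p ¬P
... | no _  = count-∅ (P? ∘ suc) ¬P

length-filter-tabulate : ∀ {A : Set a} {P : Pred A p} (P? : Decidable P) (f : Fin n → A) →
                         length (filter P? (tabulate f)) ≡ count (P? ∘ f)
length-filter-tabulate {n = zero}  P? f = refl
length-filter-tabulate {n = suc n} P? f with P? (f zero)
... | yes _ = cong suc (length-filter-tabulate P? (f ∘ suc))
... | no _  = length-filter-tabulate P? (f ∘ suc)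

-- Balanced diagrams

module _ where
  open import Data.Integer using (+_; _+_; _-_; -_)

  indicatorℤ : {A : Set a} → Dec A → ℤ
  indicatorℤ A? = if ⌊ A? ⌋ then 1ℤ else 0ℤ

  indicatorℤ-yes : {A : Set a} (A? : Dec A) → A → indicatorℤ A? ≡ 1ℤ
  indicatorℤ-yes (yes _) _ = refl
  indicatorℤ-yes (no ¬a) a = contradiction a ¬a

  indicatorℤ-no : {A : Set a} (A? : Dec A) → ¬ A → indicatorℤ A? ≡ 0ℤ
  indicatorℤ-no (yes a) ¬a = contradiction a ¬a
  indicatorℤ-no (no _)  _  = refl

  neg-indicatorℤ : {A : Set a} (A? : Dec A) → (if ⌊ A? ⌋ then -1ℤ else 0ℤ) ≡ - indicatorℤ A?
  neg-indicatorℤ (yes _) = refl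
  neg-indicatorℤ (no _)  = refl

  <⇒≤-1 : ∀ {x y} → x ℤ.< y → x ℤ.≤ y - 1ℤ
  <⇒≤-1 {y = y} x<y = subst (_ ℤ.≤_) (ℤ.+-comm -1ℤ y) (ℤ.i<j⇒i≤pred[j] x<y)

  ≤-1⇒< : ∀ {x y} → x ℤ.≤ y - 1ℤ → x ℤ.< y
  ≤-1⇒< {y = y} x≤y-1 = ℤ.i≤pred[j]⇒i<j (subst (_ ℤ.≤_) (ℤ.+-comm y -1ℤ) x≤y-1)

  indicatorℤ-≟+≤-1 : ∀ x m → indicatorℤ (x ≟ m) + indicatorℤ (x ≤? m - 1ℤ) ≡ indicatorℤ (x ≤? m)
  indicatorℤ-≟+≤-1 x m with x ≤? m | x ≟ m
  ... | yes _   | yes refl = cong (λ z → 1ℤ + z)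
                               (indicatorℤ-no (x ≤? x - 1ℤ) (ℤ.<-irrefl refl ∘ ≤-1⇒<))
  ... | yes x≤m | no x≢m   = cong (λ z → 0ℤ + z)
                               (indicatorℤ-yes (x ≤? m - 1ℤ) (<⇒≤-1 (ℤ.≤∧≢⇒< x≤m x≢m)))
  ... | no x≰m  | yes refl = contradiction ℤ.≤-refl x≰m
  ... | no x≰m  | no _     = cong (λ z → 0ℤ + z)
                               (indicatorℤ-no (x ≤? m - 1ℤ) (x≰m ∘ ℤ.<⇒≤ ∘ ≤-1⇒<))

  indicatorℤ-interval : ∀ {lo hi} m → lo ℤ.≤ hi →
    indicatorℤ ((lo ≤? m) ×-dec (m ≤? hi - 1ℤ)) + indicatorℤ (hi ≤? m) ≡ indicatorℤ (lo ≤? m)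
  indicatorℤ-interval {lo} {hi} m lo≤hi with lo ≤? m | hi ≤? m
  ... | yes lo≤m | yes hi≤m = cong (λ z → z + 1ℤ) (indicatorℤ-no (yes lo≤m ×-dec (m ≤? hi - 1ℤ))
                                λ (_ , m≤hi-1) → ℤ.<⇒≱ (≤-1⇒< m≤hi-1) hi≤m)
  ... | yes lo≤m | no hi≰m  = cong (λ z → z + 0ℤ) (indicatorℤ-yes (yes lo≤m ×-dec (m ≤? hi - 1ℤ))
                                (lo≤m , <⇒≤-1 (ℤ.≰⇒> hi≰m)))
  ... | no lo≰m  | yes hi≤m = contradiction (ℤ.≤-trans lo≤hi hi≤m) lo≰m
  ... | no _     | no _     = refl

  segment+indicatorℤ : ∀ b r m → segment b r m + indicatorℤ (r + b ≤? m) ≡ indicatorℤ (r ≤? m)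
  segment+indicatorℤ b r m with 0ℤ ℤ.<? b | b ℤ.<? 0ℤ
  ... | yes 0<b | _ = indicatorℤ-interval m r≤r+b
    where
    r≤r+b : r ℤ.≤ r + b
    r≤r+b = subst (ℤ._≤ r + b) (ℤ.+-identityʳ r) (ℤ.+-monoʳ-≤ r (ℤ.<⇒≤ 0<b))
  ... | no _ | yes b<0 = begin
      (if ⌊ interval ⌋ then -1ℤ else 0ℤ) + indicatorℤ (r + b ≤? m)
        ≡⟨ cong (_+ indicatorℤ (r + b ≤? m)) (neg-indicatorℤ interval) ⟩
      - indicatorℤ interval + indicatorℤ (r + b ≤? m)
        ≡⟨ cong (λ z → - indicatorℤ interval + z) (indicatorℤ-interval m r+b≤r) ⟨
      - indicatorℤ interval + (indicatorℤ interval + indicatorℤ (r ≤? m))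
        ≡⟨ \\-leftDividesʳ (indicatorℤ interval) (indicatorℤ (r ≤? m)) ⟩
      indicatorℤ (r ≤? m) ∎
    where
    open ≡-Reasoning
    interval = (r + b ≤? m) ×-dec (m ≤? r - 1ℤ)
    r+b≤r : r + b ℤ.≤ r
    r+b≤r = subst (r + b ℤ.≤_) (ℤ.+-identityʳ r) (ℤ.+-monoʳ-≤ r (ℤ.<⇒≤ b<0))
  ... | no 0≮b | no b≮0 rewrite ℤ.≤-antisym (ℤ.≮⇒≥ 0≮b) (ℤ.≮⇒≥ b≮0) | ℤ.+-identityʳ r =
    ℤ.+-identityˡ (indicatorℤ (r ≤? m))

  foldr-map-tabulate : ∀ {A : Set a} (f : A → ℤ) (g : Fin n → A) →
                       foldr _+_ 0ℤ (map f (tabulate g)) ≡ sum (f ∘ g)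
  foldr-map-tabulate {n = zero}  f g = refl
  foldr-map-tabulate {n = suc n} f g = cong (λ z → f (g zero) + z) (foldr-map-tabulate f (g ∘ suc))

  sum-indicatorℤ : {P : Pred (Fin n) p} (P? : Decidable P) → sum (indicatorℤ ∘ P?) ≡ + count P?
  sum-indicatorℤ {n = zero}  P? = refl
  sum-indicatorℤ {n = suc n} P? with P? zero
  ... | yes _ = cong (λ z → 1ℤ + z) (sum-indicatorℤ (P? ∘ suc))
  ... | no _  = trans (ℤ.+-identityˡ _) (sum-indicatorℤ (P? ∘ suc))

  atOrBelow : (Fin n → ℤ) → ℤ → ℤ
  atOrBelow h m = sum (λ i → indicatorℤ (h i ≤? m))

  count-at+atOrBelow : (h : Fin n → ℤ) → ∀ m →
                       + count (λ i → h i ≟ m) + atOrBelow h (m - 1ℤ) ≡ atOrBelow h m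
  count-at+atOrBelow h m = begin
    + count (λ i → h i ≟ m) + atOrBelow h (m - 1ℤ)
      ≡⟨ cong (_+ atOrBelow h (m - 1ℤ)) (sum-indicatorℤ (λ i → h i ≟ m)) ⟨
    sum (λ i → indicatorℤ (h i ≟ m)) + atOrBelow h (m - 1ℤ)
      ≡⟨ ∑-distrib-+ (λ i → indicatorℤ (h i ≟ m)) (λ i → indicatorℤ (h i ≤? m - 1ℤ)) ⟨
    sum (λ i → indicatorℤ (h i ≟ m) + indicatorℤ (h i ≤? m - 1ℤ))
      ≡⟨ sum-cong-≗ (λ i → indicatorℤ-≟+≤-1 (h i) m) ⟩
    atOrBelow h m ∎
    where open ≡-Reasoning

  module _ {N} (b r : Fin N → ℤ) (balanced : Balanced b r) where

    private
      end : Fin N → ℤ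
      end i = r i + b i

    balanced⇒atOrBelow-starts≡ends : ∀ m → atOrBelow r m ≡ atOrBelow end m
    balanced⇒atOrBelow-starts≡ends m = begin
      atOrBelow r m
        ≡⟨ sum-cong-≗ (λ i → segment+indicatorℤ (b i) (r i) m) ⟨
      sum (λ i → segment (b i) (r i) m + indicatorℤ (end i ≤? m))
        ≡⟨ ∑-distrib-+ (λ i → segment (b i) (r i) m) (λ i → indicatorℤ (end i ≤? m)) ⟩
      sum (λ i → segment (b i) (r i) m) + atOrBelow end m
        ≡⟨ cong (_+ atOrBelow end m) row-sum≡0 ⟩
      0ℤ + atOrBelow end m
        ≡⟨ ℤ.+-identityˡ _ ⟩
      atOrBelow end m ∎
      where
      open ≡-Reasoning
      row-sum≡0 : sum (λ i → segment (b i) (r i) m) ≡ 0ℤ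
      row-sum≡0 = trans (sym (foldr-map-tabulate (λ i → segment (b i) (r i) m) id)) (balanced m)

    balanced⇒#starts≡#ends : ∀ m → count (λ i → r i ≟ m) ≡ count (λ i → end i ≟ m)
    balanced⇒#starts≡#ends m = ℤ.+-injective (∙-cancelʳ (atOrBelow r (m - 1ℤ)) _ _ (begin
      + count (λ i → r i ≟ m) + atOrBelow r (m - 1ℤ)     ≡⟨ count-at+atOrBelow r m ⟩
      atOrBelow r m                                      ≡⟨ balanced⇒atOrBelow-starts≡ends m ⟩
      atOrBelow end m                                    ≡⟨ count-at+atOrBelow end m ⟨
      + count (λ i → end i ≟ m) + atOrBelow end (m - 1ℤ)
        ≡⟨ cong (λ z → + count (λ i → end i ≟ m) + z) (balanced⇒atOrBelow-starts≡ends (m - 1ℤ)) ⟨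
      + count (λ i → end i ≟ m) + atOrBelow r (m - 1ℤ)   ∎))
      where open ≡-Reasoning

module _ {A : Set} (p : A → Bool) where

  findFirst-just : ∀ {xs x} → findFirst p xs ≡ just x → x ∈ xs × T (p x)
  findFirst-just {y ∷ ys} eq with p y in py
  ... | true  with refl ← just-injective eq = here refl , subst T (sym py) _
  ... | false = Product.map₁ there (findFirst-just eq)

  findFirst-nothing : ∀ {xs x} → findFirst p xs ≡ nothing → x ∈ xs → ¬ T (p x)
  findFirst-nothing {y ∷ ys} eq x∈ with p y in py | x∈
  ... | true  | _          = contradiction eq λ ()
  ... | false | here refl  = subst (¬_ ∘ T) (sym py) id
  ... | false | there x∈ys = findFirst-nothing eq x∈ys

  findFirst-++ : ∀ xs ys → findFirst p (xs ++ ys) ≡ (findFirst p xs <∣> findFirst p ys)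
  findFirst-++ []       ys = refl
  findFirst-++ (x ∷ xs) ys with p x
  ... | true  = refl
  ... | false = findFirst-++ xs ys

  findFirst-reverse-∷ : ∀ y ys →
                        findFirst p (reverse (y ∷ ys)) ≡ (findFirst p (reverse ys) <∣> findFirst p [ y ])
  findFirst-reverse-∷ y ys = trans (cong (findFirst p) (unfold-reverse y ys)) (findFirst-++ (reverse ys) [ y ])

  findFirst-reverse-last : ∀ {ℓ} {_<_ : Rel A ℓ} → Asymmetric _<_ → ∀ {xs x i} → AllPairs _<_ xs →
                           findFirst p (reverse xs) ≡ just x → i ∈ xs → x < i → ¬ T (p i)
  findFirst-reverse-last asym {y ∷ ys} (y<ys ∷ ys↗) eq i∈ x<i
    rewrite findFirst-reverse-∷ y ys
    with findFirst p (reverse ys) in eq′ | i∈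
  ... | just _  | here refl with refl ← eq =
    contradiction (All.lookup y<ys (reverse⁻ (proj₁ (findFirst-just eq′)))) (asym x<i)
  ... | just _  | there i∈ys with refl ← eq = findFirst-reverse-last asym ys↗ eq′ i∈ys x<i
  ... | nothing | here refl with refl ← singleton⁻ (proj₁ (findFirst-just eq)) = ⊥-elim (asym x<i x<i)
  ... | nothing | there i∈ys = findFirst-nothing eq′ (reverse⁺ i∈ys)

lookup-injective : ∀ {A : Set} {xs : List A} → Unique xs → ∀ {i j} → lookup xs i ≡ lookup xs j → i ≡ j
lookup-injective {xs = _ ∷ _} _          {zero}  {zero}  _  = refl
lookup-injective {xs = _ ∷ _} (x∉ ∷ _)   {zero}  {suc j} eq = ⊥-elim (All.lookup x∉ (∈-lookup j) eq)
lookup-injective {xs = _ ∷ _} (x∉ ∷ _)   {suc i} {zero}  eq = ⊥-elim (All.lookup x∉ (∈-lookup i) (sym eq))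
lookup-injective {xs = _ ∷ _} (_ ∷ uniq) {suc i} {suc j} eq = cong suc (lookup-injective uniq eq)

Is-just⇒≡just : ∀ {A : Set} {m : Maybe A} → Is-just m → ∃[ x ] m ≡ just x
Is-just⇒≡just (just _) = _ , refl

module StepTwo {N : ℕ} (b r : Fin N → ℤ) where
  open import Data.List.Membership.DecPropositional (Fin._≟_ {N}) using (_∈?_)
  open import Data.Nat using (_+_)
  open State

  end : Fin N → ℤ
  end i = r i ℤ.+ b i

  startsAt : ∀ m → Decidable (λ i → r i ≡ m)
  startsAt m i = r i ≟ m

  endsAt : ∀ m → Decidable (λ i → end i ≡ m)
  endsAt m i = end i ≟ m

  leaving entering : List (Fin N) → ℤ → ℕ
  leaving  L m = count (startsAt m ∩? (_∈? L))
  entering L m = count (endsAt m ∩? (_∈? L))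

  size : List (Fin N) → ℕ
  size L = count (_∈? L)

  count-∩-[] : {P : Pred (Fin N) p} (P? : Decidable P) → count (P? ∩? (_∈? [])) ≡ 0
  count-∩-[] P? = count-∅ (P? ∩? (_∈? [])) λ ()

  count-∩-∷ : {P : Pred (Fin N) p} (P? : Decidable P) → ∀ {j L} → j ∉ L →
              count (P? ∩? (_∈? (j ∷ L))) ≡ indicator (P? j) + count (P? ∩? (_∈? L))
  count-∩-∷ P? {j} {L} j∉L with P? j
  ... | yes pj = count-insert (P? ∩? (_∈? L)) (P? ∩? (_∈? (j ∷ L))) (j∉L ∘ proj₂) (pj , here refl)
                   λ i≢j → mk⇔ (Product.map₂ there) (Product.map₂ (Any.tail i≢j))
  ... | no ¬pj = count-cong (P? ∩? (_∈? (j ∷ L))) (P? ∩? (_∈? L))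
                   (mk⇔ (λ (pi , i∈) → pi , Any.tail (λ { refl → ¬pj pi }) i∈) (Product.map₂ there))

  size-∷ : ∀ {j L} → j ∉ L → size (j ∷ L) ≡ suc (size L)
  size-∷ j∉L = count-insert (_∈? _) (_∈? _) j∉L (here refl) λ i≢j → mk⇔ there (Any.tail i≢j)

  Trail : List (Fin N) → ℤ → Set
  Trail L ℓ = ∀ m → entering L m + indicator (0ℤ ≟ m) ≡ indicator (ℓ ≟ m) + leaving L m

  trail-[] : Trail [] 0ℤ
  trail-[] m = begin
    entering [] m + indicator (0ℤ ≟ m)  ≡⟨ cong (_+ indicator (0ℤ ≟ m)) (count-∩-[] (endsAt m)) ⟩
    indicator (0ℤ ≟ m)                   ≡⟨ ℕ.+-identityʳ _ ⟨
    indicator (0ℤ ≟ m) + 0               ≡⟨ cong (indicator (0ℤ ≟ m) +_) (count-∩-[] (startsAt m)) ⟨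
    indicator (0ℤ ≟ m) + leaving [] m    ∎
    where open ≡-Reasoning

  trail-∷ : ∀ {j L} → Trail L (r j) → j ∉ L → Trail (j ∷ L) (end j)
  trail-∷ {j} {L} trail j∉L m = begin
    entering (j ∷ L) m + indicator (0ℤ ≟ m)
      ≡⟨ cong (_+ indicator (0ℤ ≟ m)) (count-∩-∷ (endsAt m) j∉L) ⟩
    indicator (end j ≟ m) + entering L m + indicator (0ℤ ≟ m)
      ≡⟨ ℕ.+-assoc (indicator (end j ≟ m)) _ _ ⟩
    indicator (end j ≟ m) + (entering L m + indicator (0ℤ ≟ m))
      ≡⟨ cong (indicator (end j ≟ m) +_) (trail m) ⟩
    indicator (end j ≟ m) + (indicator (r j ≟ m) + leaving L m)
      ≡⟨ cong (indicator (end j ≟ m) +_) (count-∩-∷ (startsAt m) j∉L) ⟨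
    indicator (end j ≟ m) + leaving (j ∷ L) m ∎
    where open ≡-Reasoning

  trail-surplus : ∀ {L ℓ} → Trail L ℓ → ℓ ≢ 0ℤ → entering L ℓ ≡ suc (leaving L ℓ)
  trail-surplus {L} {ℓ} trail ℓ≢0 with 0ℤ ≟ ℓ | ℓ ≟ ℓ | trail ℓ
  ... | yes 0≡ℓ | _      | _  = contradiction (sym 0≡ℓ) ℓ≢0
  ... | no _    | no ℓ≢ℓ | _  = contradiction refl ℓ≢ℓ
  ... | no _    | yes _  | eq = trans (sym (ℕ.+-identityʳ _)) eq

  trail-closed : ∀ {L} → Trail L 0ℤ → ∀ m → entering L m ≡ leaving L m
  trail-closed {L} trail m =
    ℕ.+-cancelʳ-≡ (indicator (0ℤ ≟ m)) _ _
      (trans (trail m) (ℕ.+-comm (indicator (0ℤ ≟ m)) (leaving L m)))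

  trail-has-unused-exit : ∀ {L U ℓ} → Trail L ℓ → ℓ ≢ 0ℤ → L ⊆ U → entering U ℓ ≤ leaving U ℓ →
                          ¬ (∀ {i} → r i ≡ ℓ → i ∈ U → i ∈ L)
  trail-has-unused-exit {L} {U} {ℓ} trail ℓ≢0 L⊆U in≤out exits-used = ℕ.<-irrefl refl (begin-strict
    leaving L ℓ   <⟨ ℕ.≤-reflexive (sym (trail-surplus trail ℓ≢0)) ⟩
    entering L ℓ  ≤⟨ count-mono (endsAt ℓ ∩? (_∈? L)) (endsAt ℓ ∩? (_∈? U)) (Product.map₂ L⊆U) ⟩
    entering U ℓ  ≤⟨ in≤out ⟩
    leaving U ℓ   ≤⟨ count-mono (startsAt ℓ ∩? (_∈? U)) (startsAt ℓ ∩? (_∈? L))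
                                (λ (ri≡ℓ , i∈U) → ri≡ℓ , exits-used ri≡ℓ i∈U) ⟩
    leaving L ℓ   ∎)
    where open ℕ.≤-Reasoning

  balanced⇒entering≡leaving-allFin : Balanced b r → ∀ m → entering (allFin N) m ≡ leaving (allFin N) m
  balanced⇒entering≡leaving-allFin balanced m = begin
    entering (allFin N) m  ≡⟨ count-cong (endsAt m ∩? (_∈? allFin N)) (endsAt m) (mk⇔ proj₁ (_, ∈-allFin _)) ⟩
    count (endsAt m)       ≡⟨ balanced⇒#starts≡#ends b r balanced m ⟨
    count (startsAt m)     ≡⟨ count-cong (startsAt m) (startsAt m ∩? (_∈? allFin N)) (mk⇔ (_, ∈-allFin _) proj₁) ⟩
    leaving (allFin N) m   ∎
    where open ≡-Reasoning

  RightClosed : List (Fin N) → Set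
  RightClosed L = ∀ {i j} → i Fin.< j → r i ≡ r j → r i ≢ 0ℤ → i ∈ L → j ∈ L

  rightClosed-∷ : ∀ {j L} → RightClosed L → (∀ {k} → j Fin.< k → r j ≡ r k → r j ≢ 0ℤ → k ∈ L) →
                  RightClosed (j ∷ L)
  rightClosed-∷ closed j-closed i<k ri≡rk ri≢0 (here refl)  = there (j-closed i<k ri≡rk ri≢0)
  rightClosed-∷ closed j-closed i<k ri≡rk ri≢0 (there i∈L) = there (closed i<k ri≡rk ri≢0 i∈L)

  record Closed (U : List (Fin N)) : Set where
    field
      balanced     : ∀ m → entering U m ≡ leaving U m
      right-closed : RightClosed U
      ground       : ∀ {i} → r i ≡ 0ℤ → i ∈ U

  unlabelledAt : List (Fin N) → ℤ → Fin N → Bool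
  unlabelledAt L ℓ i = ⌊ (r i ≟ ℓ) ×-dec ¬? (i ∈? L) ⌋

  record RightmostUnlabelled (L : List (Fin N)) (ℓ : ℤ) (j : Fin N) : Set where
    field
      at-level   : r j ≡ ℓ
      unlabelled : j ∉ L
      rightmost  : ∀ {i} → j Fin.< i → r i ≡ ℓ → i ∈ L

  rightmost-just : ∀ {L ℓ j} → rightmostAt r L ℓ ≡ just j → RightmostUnlabelled L ℓ j
  rightmost-just {L} {ℓ} {j} found = record
    { at-level   = proj₁ (toWitness j-unlabelled)
    ; unlabelled = proj₂ (toWitness j-unlabelled)
    ; rightmost  = λ {i} j<i ri≡ℓ → decidable-stable (i ∈? L) λ i∉L →
        findFirst-reverse-last (unlabelledAt L ℓ) Fin.<-asym (tabulate⁺-< id) found (∈-allFin i) j<i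
          (fromWitness (ri≡ℓ , i∉L))
    }
    where j-unlabelled = proj₂ (findFirst-just (unlabelledAt L ℓ) {reverse (allFin N)} found)

  rightmost-nothing : ∀ {L ℓ} → rightmostAt r L ℓ ≡ nothing → ∀ {i} → r i ≡ ℓ → i ∈ L
  rightmost-nothing {L} {ℓ} none {i} ri≡ℓ = decidable-stable (i ∈? L) λ i∉L →
    findFirst-nothing (unlabelledAt L ℓ) {reverse (allFin N)} none (reverse⁺ (∈-allFin i))
      (fromWitness (ri≡ℓ , i∉L))

  module _ (φ : Permutation′ (numLevel0 r)) where

    chosen-at-ground : ∀ {c j} → chooseLevel0 r φ c ≡ just j → r j ≡ 0ℤ
    chosen-at-ground {c} chosen with c ℕ.∸ 1 ℕ.<? numLevel0 r
    ... | yes c∸1<k with refl ← chosen =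
      proj₂ (∈-filter⁻ (startsAt 0ℤ) {xs = allFin N} (∈-lookup (φ ⟨$⟩ˡ fromℕ< c∸1<k)))
    ... | no _ = contradiction chosen λ ()

    chosen-injective : ∀ {c c′ j} →
                       chooseLevel0 r φ (suc c) ≡ just j → chooseLevel0 r φ (suc c′) ≡ just j → c ≡ c′
    chosen-injective {c} {c′} chosen chosen′ with c ℕ.<? numLevel0 r | c′ ℕ.<? numLevel0 r
    ... | yes c<k | yes c′<k = begin
      c                      ≡⟨ Fin.toℕ-fromℕ< c<k ⟨
      Fin.toℕ (fromℕ< c<k)   ≡⟨ cong Fin.toℕ (Injection.injective (↔⇒↣ (Perm.flip φ)) same-position) ⟩
      Fin.toℕ (fromℕ< c′<k)  ≡⟨ Fin.toℕ-fromℕ< c′<k ⟩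
      c′                     ∎
      where
      open ≡-Reasoning
      same-position = lookup-injective (filter⁺ (startsAt 0ℤ) (allFin⁺ N))
                                       (just-injective (trans chosen (sym chosen′)))
    ... | yes _ | no _ = contradiction chosen′ λ ()
    ... | no _  | _    = contradiction chosen λ ()

    unchosen⇒exhausted : ∀ {c} → chooseLevel0 r φ (suc c) ≡ nothing → count (startsAt 0ℤ) ≤ c
    unchosen⇒exhausted {c} none with c ℕ.<? numLevel0 r
    ... | yes _  = contradiction none λ ()
    ... | no c≮k = subst (_≤ c) (length-filter-tabulate (startsAt 0ℤ) id) (ℕ.≮⇒≥ c≮k)

    data Step : State N → State N → Set where
      pick-ground : ∀ {n L j} → chooseLevel0 r φ (suc n) ≡ just j → j ∉ L →
                    Step (st 0ℤ n L) (st (end j) (suc n) (j ∷ L))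
      follow      : ∀ {ℓ n L j} → ℓ ≢ 0ℤ → rightmostAt r L ℓ ≡ just j →
                    Step (st ℓ n L) (st (end j) n (j ∷ L))

    step-just : ∀ {s s′} → step b r φ s ≡ just s′ → Step s s′
    step-just {st ℓ n L} eq with ℓ ≟ 0ℤ
    ... | yes refl with chooseLevel0 r φ (suc n) in chosen
    ...   | nothing = contradiction eq λ ()
    ...   | just j with j ∈? L
    ...     | yes _  = contradiction eq λ ()
    ...     | no j∉L with refl ← eq = pick-ground chosen j∉L
    step-just {st ℓ n L} eq | no ℓ≢0 with rightmostAt r L ℓ in found
    ...   | nothing = contradiction eq λ ()
    ...   | just j with refl ← eq = follow ℓ≢0 found

    data Stuck : State N → Set where
      ground-exhausted : ∀ {n L} → chooseLevel0 r φ (suc n) ≡ nothing → Stuck (st 0ℤ n L)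
      ground-repeated  : ∀ {n L j} → chooseLevel0 r φ (suc n) ≡ just j → j ∈ L → Stuck (st 0ℤ n L)
      dead-end         : ∀ {ℓ n L} → ℓ ≢ 0ℤ → rightmostAt r L ℓ ≡ nothing → Stuck (st ℓ n L)

    step-nothing : ∀ {s} → step b r φ s ≡ nothing → Stuck s
    step-nothing {st ℓ n L} eq with ℓ ≟ 0ℤ
    ... | yes refl with chooseLevel0 r φ (suc n) in chosen
    ...   | nothing = ground-exhausted chosen
    ...   | just j with j ∈? L
    ...     | yes j∈L = ground-repeated chosen j∈L
    ...     | no _    = contradiction eq λ ()
    step-nothing {st ℓ n L} eq | no ℓ≢0 with rightmostAt r L ℓ in found
    ...   | nothing = dead-end ℓ≢0 found
    ...   | just _  = contradiction eq λ ()

    record Invariant (s : State N) : Set where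
      field
        trail         : Trail (labelled s) (level s)
        right-closed  : RightClosed (labelled s)
        ground-chosen : ∀ {i} → r i ≡ 0ℤ → i ∈ labelled s →
                        ∃[ c ] c < counter s × chooseLevel0 r φ (suc c) ≡ just i
        ground-count  : leaving (labelled s) 0ℤ ≡ counter s

    invariant-initial : Invariant (st 0ℤ 0 [])
    invariant-initial = record
      { trail         = trail-[]
      ; right-closed  = λ _ _ _ ()
      ; ground-chosen = λ _ ()
      ; ground-count  = count-∩-[] (startsAt 0ℤ)
      }

    invariant-step : ∀ {s s′} → Invariant s → Step s s′ → Invariant s′
    invariant-step {st _ n L} inv (pick-ground {j = j} chosen j∉L) = record
      { trail         = trail-∷ (subst (Trail L) (sym rj≡0) trail) j∉L
      ; right-closed  = rightClosed-∷ right-closed λ _ _ rj≢0 → contradiction rj≡0 rj≢0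
      ; ground-chosen = λ where
          _    (here refl) → n , ℕ.n<1+n n , chosen
          ri≡0 (there i∈L) → Product.map₂ (Product.map₁ ℕ.m<n⇒m<1+n) (ground-chosen ri≡0 i∈L)
      ; ground-count  = trans (count-∩-∷ (startsAt 0ℤ) j∉L)
                              (cong₂ _+_ (indicator-yes (startsAt 0ℤ j) rj≡0) ground-count)
      }
      where
      open Invariant inv
      rj≡0 = chosen-at-ground chosen
    invariant-step {st ℓ n L} inv (follow {j = j} ℓ≢0 found) = record
      { trail         = trail-∷ (subst (Trail L) (sym at-level) trail) unlabelled
      ; right-closed  = rightClosed-∷ right-closed λ j<k rj≡rk _ → rightmost j<k (trans (sym rj≡rk) at-level)
      ; ground-chosen = λ where
          rj≡0 (here refl) → contradiction (trans (sym at-level) rj≡0) ℓ≢0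
          ri≡0 (there i∈L) → ground-chosen ri≡0 i∈L
      ; ground-count  = trans (count-∩-∷ (startsAt 0ℤ) unlabelled)
                              (cong₂ _+_ (indicator-no (startsAt 0ℤ j) (ℓ≢0 ∘ trans (sym at-level))) ground-count)
      }
      where
      open Invariant inv
      open RightmostUnlabelled (rightmost-just found)

    size-step : ∀ {s s′} → Step s s′ → size (labelled s′) ≡ suc (size (labelled s))
    size-step (pick-ground _ j∉L) = size-∷ j∉L
    size-step (follow _ found)    = size-∷ (RightmostUnlabelled.unlabelled (rightmost-just found))

    size-step-+ : ∀ {s s′} → Step s s′ → ∀ m → size (labelled s′) + m ≡ size (labelled s) + suc m
    size-step-+ step m = trans (cong (_+ m) (size-step step)) (sym (ℕ.+-suc _ m))

    stuck⇒closed : Balanced b r → ∀ {s} → Invariant s → Stuck s → Closed (labelled s)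
    stuck⇒closed _ {st _ n L} inv (ground-exhausted none) = record
      { balanced     = trail-closed trail
      ; right-closed = right-closed
      ; ground       = λ {i} ri≡0 → decidable-stable (i ∈? L) λ i∉L → ℕ.<-irrefl refl (begin-strict
          leaving L 0ℤ        <⟨ count-mono-< (startsAt 0ℤ ∩? (_∈? L)) (startsAt 0ℤ) proj₁ (i∉L ∘ proj₂) ri≡0 ⟩
          count (startsAt 0ℤ) ≤⟨ unchosen⇒exhausted none ⟩
          n                   ≡⟨ ground-count ⟨
          leaving L 0ℤ        ∎)
      }
      where
      open Invariant inv
      open ℕ.≤-Reasoning
    stuck⇒closed _ inv (ground-repeated chosen j∈L)
      with c , c<n , chosen-before ← Invariant.ground-chosen inv (chosen-at-ground chosen) j∈L =
      ⊥-elim (ℕ.<⇒≢ c<n (chosen-injective chosen-before chosen))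
    stuck⇒closed balanced inv (dead-end ℓ≢0 none) =
      ⊥-elim (trail-has-unused-exit (Invariant.trail inv) ℓ≢0 (λ _ → ∈-allFin _)
                (ℕ.≤-reflexive (balanced⇒entering≡leaving-allFin balanced _))
                λ ri≡ℓ _ → rightmost-nothing none ri≡ℓ)

    step-confined : ∀ {U} → Closed U → ∀ {s s′} → Invariant s → labelled s ⊆ U → Step s s′ →
                    labelled s′ ⊆ U
    step-confined closed _ L⊆U (pick-ground chosen _) =
      ∈-∷⁺ʳ (Closed.ground closed (chosen-at-ground chosen)) L⊆U
    step-confined {U} closed {st ℓ n L} inv L⊆U (follow {j = j} ℓ≢0 found) =
      ∈-∷⁺ʳ (decidable-stable (j ∈? U) j∈U) L⊆U
      where
      open RightmostUnlabelled (rightmost-just found)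
      j∈U : ¬ j ∉ U
      j∈U j∉U = trail-has-unused-exit (Invariant.trail inv) ℓ≢0 L⊆U
                  (ℕ.≤-reflexive (Closed.balanced closed ℓ)) exits-used
        where
        exits-used : ∀ {i} → r i ≡ ℓ → i ∈ U → i ∈ L
        exits-used {i} ri≡ℓ i∈U with Fin.<-cmp i j
        ... | tri< i<j _ _  = contradiction (Closed.right-closed closed i<j (trans ri≡ℓ (sym at-level))
                                                                     (ℓ≢0 ∘ trans (sym ri≡ℓ)) i∈U) j∉U
        ... | tri≈ _ refl _ = contradiction i∈U j∉U
        ... | tri> _ _ j<i  = rightmost j<i ri≡ℓ

    run-stuck : ∀ m {s} → Invariant s → run b r φ m s ≡ nothing →
                ∃[ s′ ] Invariant s′ × Stuck s′ × size (labelled s′) < size (labelled s) + m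
    run-stuck (suc m) {s} inv fails with step b r φ s in stepped
    ... | nothing = s , inv , step-nothing {s} stepped , ℕ.m<m+n _ (s≤s z≤n)
    ... | just s₁ with step₁ ← step-just {s} stepped
                  with s′ , inv′ , stuck , small ← run-stuck m (invariant-step inv step₁) fails =
      s′ , inv′ , stuck , subst (size (labelled s′) <_) (size-step-+ step₁ m) small

    run-confined : ∀ {U} → Closed U → ∀ m {s s′} → Invariant s → labelled s ⊆ U →
                   run b r φ m s ≡ just s′ → labelled s′ ⊆ U × size (labelled s′) ≡ size (labelled s) + m
    run-confined closed zero    inv L⊆U refl = L⊆U , sym (ℕ.+-identityʳ _)
    run-confined closed (suc m) {s} inv L⊆U done with step b r φ s in stepped
    ... | nothing = contradiction done λ ()
    ... | just s₁ with step₁ ← step-just {s} stepped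
                  with L′⊆U , grows ← run-confined closed m (invariant-step inv step₁)
                                             (step-confined closed inv L⊆U step₁) done =
      L′⊆U , trans grows (size-step-+ step₁ m)

  initial : State N
  initial = st 0ℤ 0 []

  stuck-run-excludes-complete-run : Balanced b r → ∀ φ ψ {s′} →
                                    run b r ψ N initial ≡ nothing → run b r φ N initial ≡ just s′ → ⊥
  stuck-run-excludes-complete-run balanced φ ψ {s′} ψ-fails φ-done
    with U , inv , stuck , small ← run-stuck ψ N (invariant-initial ψ) ψ-fails
    with s′⊆U , grows ← run-confined φ (stuck⇒closed ψ balanced inv stuck) N
                                       (invariant-initial φ) (λ ()) φ-done =
    ℕ.<-irrefl refl (begin-strict
      size [] + N         ≡⟨ grows ⟨
      size (labelled s′)  ≤⟨ count-mono (_∈? labelled s′) (_∈? labelled U) s′⊆U ⟩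
      size (labelled U)   <⟨ small ⟩
      size [] + N         ∎)
    where open ℕ.≤-Reasoning

  stable-transfer : Balanced b r → ∀ φ ψ → Stable b r φ → Stable b r ψ
  stable-transfer balanced φ ψ stable-φ with run b r ψ N initial in ψ-run
  ... | just _  = just tt
  ... | nothing =
    ⊥-elim (stuck-run-excludes-complete-run balanced φ ψ ψ-run (proj₂ (Is-just⇒≡just stable-φ)))

-- The starting levels need not be increasing for this argument.
lemma4 : (N : ℕ) (b r : Fin N → ℤ) →
    Increasing r → Balanced b r →
    (φ ψ : Permutation′ (numLevel0 r)) →
    Stable b r φ ⇔ Stable b r ψ
lemma4 N b r _ balanced φ ψ = mk⇔ (stable-transfer balanced φ ψ) (stable-transfer balanced ψ φ)
  where open StepTwo b r
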